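{- Let $L_1,\dots,L_k\subseteq\mathcal{H}_n$ be root subspaces such that $L_s\cap L_t$ is a root subspace for all $1\le s,t\le k$. Then $L_1\cap\dots\cap L_k$ is a root subspace.
   Context: $\mathcal{H}_n=\{x\in\mathbb{R}^n:x_1+\dots+x_n=0\}$. The roots of type $A$ are the vectors $e_{ij}=e_i-e_j$ for $i\ne j$. A linear subspace $L\subseteq\mathcal{H}_n$ is a root subspace if it is spanned by roots (the zero subspace counts as spanned by the empty set of roots).
   Formalization: Stated over the rationals: the subspaces $L_1,\dots,L_k$ lie in ℚ^n instead of $\mathbb{R}^n$, and being a root subspace means being spanned by roots over ℚ. -}

module Defs where

open import Data.Nat using (ℕ)
open import Data.Fin using (Fin)
open import Data.Fin.Properties using () renaming (_≟_ to _≟ᶠ_)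
open import Data.Rational using (ℚ; 0ℚ; 1ℚ; _+_; _-_; _*_)
open import Data.List using (List; []; _∷_)
open import Data.List.Relation.Unary.All using (All)
open import Data.List.Membership.Propositional using (_∈_)
open import Data.Product using (Σ; _×_; _,_; proj₁; proj₂)
open import Relation.Binary.PropositionalEquality using (_≡_; _≢_)
open import Relation.Nullary using (yes; no)
open import Function.Bundles using (_⇔_)

Vecℚ : ℕ → Set
Vecℚ n = Fin n → ℚ

e : ∀ {n} → Fin n → Vecℚ n
e i m with i ≟ᶠ m
... | yes _ = 1ℚ
... | no _  = 0ℚ

-- The root e_{ij} = e_i - e_j (a genuine root when i ≢ j).
root : ∀ {n} → Fin n × Fin n → Vecℚ n
root (i , j) m = e i m - e j m

lincomb : ∀ {n} → List (ℚ × (Fin n × Fin n)) → Vecℚ n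
lincomb []              m = 0ℚ
lincomb ((q , ij) ∷ cs) m = q * root ij m + lincomb cs m

InSpan : ∀ {n} → List (Fin n × Fin n) → Vecℚ n → Set
InSpan {n} R x =
  Σ (List (ℚ × (Fin n × Fin n))) λ cs →
    All (λ c → proj₂ c ∈ R) cs × (∀ m → x m ≡ lincomb cs m)

IsRootSubspace : ∀ {n} → (Vecℚ n → Set) → Set
IsRootSubspace {n} L =
  Σ (List (Fin n × Fin n)) λ R →
    All (λ ij → proj₁ ij ≢ proj₂ ij) R × (∀ x → L x ⇔ InSpan R x)

{-# OPTIONS --safe #-}
module Submission where

-- Write L s = span (R s) and L s ∩ L t = span Rₛₜ.  Label each vertex of Fin n by its
-- connected component in the graph R s, for every s; then e_i − e_j ∈ span (R s) iff i and j
-- get the same label.  Let R⋆ join all i ≠ j carrying the same labels for every s.  Each root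
-- of R⋆ lies in every L s, so span R⋆ ⊆ ⋂ L.  Conversely, span (R s) is closed under
-- multiplication by functions constant on the components of R s.  Applied to span Rₛₜ, whose
-- roots join vertices in one component of R t, this lets us multiply y ∈ ⋂ L successively by
-- the indicators of the R t-components of a vertex m₀, for all t, and stay in ⋂ L.  The result
-- lies in L s₀, so its coordinates sum to 0: y has zero sum on every R⋆-class, and such
-- vectors are exactly span R⋆.

open import Defs
open import Algebra.Bundles using (CommutativeRing)
open import Data.Nat using (ℕ; zero; suc; _≤_)
open import Data.Fin using (Fin; zero; suc; fromℕ<)
open import Data.Fin.Properties using (any?; suc-injective) renaming (_≟_ to _≟ᶠ_)
open import Data.Rational using (ℚ; 0ℚ; 1ℚ; _+_; _-_; _*_; -_)
import Data.Rational.Properties as ℚ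
open import Data.Rational.Solver using (module +-*-Solver)
open import Algebra.Properties.Semiring.Sum (CommutativeRing.semiring ℚ.+-*-commutativeRing) using (sum-syntax; sum-cong-≗; sum-replicate-zero; ∑-distrib-+; *-distribˡ-sum)
open import Data.Vec using (Vec; _∷_; tabulate; lookup)
open import Data.Vec.Properties using (∷-injective; lookup∘tabulate; ≡-dec)
open import Data.List using (List; []; _∷_; filter; allFin; cartesianProduct)
open import Data.List.Relation.Unary.All as All using (All; []; _∷_)
open import Data.List.Relation.Unary.Any using (here; there)
open import Data.List.Relation.Binary.Subset.Propositional using (_⊆_)
open import Data.List.Membership.Propositional using (_∈_)
open import Data.List.Membership.Propositional.Properties using (∈-filter⁺; ∈-filter⁻; ∈-allFin; ∈-cartesianProduct⁺)
open import Data.Product using (∃; _×_; _,_; proj₁; proj₂; uncurry)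
open import Data.Empty using (⊥-elim-irr)
open import Function.Base using (_∘_)
open import Function.Bundles using (_⇔_; mk⇔; Equivalence)
open import Relation.Binary.Definitions using (DecidableEquality)
open import Relation.Binary.PropositionalEquality using (_≡_; _≢_; _≗_; refl; sym; trans; cong; cong₂; module ≡-Reasoning)
open import Relation.Nullary using (Dec; yes; no; ¬_; ¬?; _×-dec_)
open import Relation.Nullary.Negation using (contradiction)
open import Relation.Unary using (Decidable)

open +-*-Solver
open ≡-Reasoning
open Equivalence using (to; from)

𝟙 : ∀ {p} {P : Set p} → Dec P → ℚ
𝟙 (yes _) = 1ℚ
𝟙 (no _)  = 0ℚ

module _ {p} {P : Set p} where

  𝟙-yes : (P? : Dec P) → P → 𝟙 P? ≡ 1ℚ
  𝟙-yes (yes _) _  = refl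
  𝟙-yes (no ¬p) p  = contradiction p ¬p

  𝟙-no : (P? : Dec P) → ¬ P → 𝟙 P? ≡ 0ℚ
  𝟙-no (yes p) ¬p = contradiction p ¬p
  𝟙-no (no _)  _  = refl

module _ {p q} {P : Set p} {Q : Set q} where

  𝟙-cong : P ⇔ Q → (P? : Dec P) (Q? : Dec Q) → 𝟙 P? ≡ 𝟙 Q?
  𝟙-cong _   (yes _) (yes _) = refl
  𝟙-cong P⇔Q (yes p) (no ¬q) = contradiction (to P⇔Q p) ¬q
  𝟙-cong P⇔Q (no ¬p) (yes q) = contradiction (from P⇔Q q) ¬p
  𝟙-cong _   (no _)  (no _)  = refl

  𝟙-× : (P? : Dec P) (Q? : Dec Q) → 𝟙 (P? ×-dec Q?) ≡ 𝟙 P? * 𝟙 Q?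
  𝟙-× (yes _) (yes _) = refl
  𝟙-× (yes _) (no _)  = refl
  𝟙-× (no _)  (yes _) = refl
  𝟙-× (no _)  (no _)  = refl

∑-distrib-minus : ∀ {n} (f g : Fin n → ℚ) →
  ∑[ m < n ] (f m - g m) ≡ ∑[ m < n ] f m - ∑[ m < n ] g m
∑-distrib-minus {zero}  f g = refl
∑-distrib-minus {suc n} f g = begin
  (f zero - g zero) + ∑[ m < n ] (f (suc m) - g (suc m))
    ≡⟨ cong ((f zero - g zero) +_) (∑-distrib-minus (f ∘ suc) (g ∘ suc)) ⟩
  (f zero - g zero) + (∑f - ∑g)
    ≡⟨ solve 4 (λ a b c d → (a :- b) :+ (c :- d) := (a :+ c) :- (b :+ d)) refl (f zero) (g zero) ∑f ∑g ⟩
  (f zero + ∑f) - (g zero + ∑g) ∎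
  where
  ∑f ∑g : ℚ
  ∑f = ∑[ m < n ] f (suc m)
  ∑g = ∑[ m < n ] g (suc m)

*-distribˡ-minus : ∀ a x y → a * (x - y) ≡ a * x - a * y
*-distribˡ-minus = solve 3 (λ a x y → a :* (x :- y) := a :* x :- a :* y) refl

module _ {n : ℕ} where

  e≡𝟙 : (i m : Fin n) → e i m ≡ 𝟙 (i ≟ᶠ m)
  e≡𝟙 i m with i ≟ᶠ m
  ... | yes _ = refl
  ... | no _  = refl

  e-comm : (i m : Fin n) → e i m ≡ e m i
  e-comm i m = begin
    e i m          ≡⟨ e≡𝟙 i m ⟩
    𝟙 (i ≟ᶠ m)     ≡⟨ 𝟙-cong (mk⇔ sym sym) (i ≟ᶠ m) (m ≟ᶠ i) ⟩
    𝟙 (m ≟ᶠ i)     ≡⟨ e≡𝟙 m i ⟨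
    e m i          ∎

  e-sift : (d : Fin n → ℚ) (i m : Fin n) → d m * e i m ≡ d i * e i m
  e-sift d i m with i ≟ᶠ m
  ... | yes refl = refl
  ... | no _     = trans (ℚ.*-zeroʳ (d m)) (sym (ℚ.*-zeroʳ (d i)))

  root-sift : (d : Fin n → ℚ) {i j : Fin n} → d i ≡ d j →
              ∀ m → d m * root (i , j) m ≡ d i * root (i , j) m
  root-sift d {i} {j} dᵢ≡dⱼ m = begin
    d m * (e i m - e j m)      ≡⟨ *-distribˡ-minus (d m) (e i m) (e j m) ⟩
    d m * e i m - d m * e j m  ≡⟨ cong₂ _-_ (e-sift d i m) (trans (e-sift d j m) (cong (_* e j m) (sym dᵢ≡dⱼ))) ⟩
    d i * e i m - d i * e j m  ≡⟨ *-distribˡ-minus (d i) (e i m) (e j m) ⟨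
    d i * (e i m - e j m)      ∎

  *-distribˡ-+-sift : (d : Fin n → ℚ) {i j : Fin n} → d i ≡ d j → ∀ q (x : Vecℚ n) m →
             d m * (q * root (i , j) m + x m) ≡ q * d i * root (i , j) m + d m * x m
  *-distribˡ-+-sift d {i} {j} dᵢ≡dⱼ q x m = begin
    d m * (q * root (i , j) m + x m)
      ≡⟨ solve 4 (λ a b c z → a :* (b :* c :+ z) := b :* (a :* c) :+ a :* z) refl
                 (d m) q (root (i , j) m) (x m) ⟩
    q * (d m * root (i , j) m) + d m * x m
      ≡⟨ cong (λ t → q * t + d m * x m) (root-sift d dᵢ≡dⱼ m) ⟩
    q * (d i * root (i , j) m) + d m * x m
      ≡⟨ cong (_+ d m * x m) (ℚ.*-assoc q (d i) (root (i , j) m)) ⟨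
    q * d i * root (i , j) m + d m * x m ∎

e-suc : ∀ {n} (i m : Fin n) → e (suc i) (suc m) ≡ e i m
e-suc i m = begin
  e (suc i) (suc m)      ≡⟨ e≡𝟙 (suc i) (suc m) ⟩
  𝟙 (suc i ≟ᶠ suc m)     ≡⟨ 𝟙-cong (mk⇔ suc-injective (cong suc)) (suc i ≟ᶠ suc m) (i ≟ᶠ m) ⟩
  𝟙 (i ≟ᶠ m)             ≡⟨ e≡𝟙 i m ⟨
  e i m                  ∎

∑-e : ∀ {n} (i : Fin n) → ∑[ m < n ] e i m ≡ 1ℚ
∑-e {suc n} zero    = trans (cong (1ℚ +_) (sum-replicate-zero n)) (ℚ.+-identityʳ 1ℚ)
∑-e {suc n} (suc i) = trans (ℚ.+-identityˡ _) (trans (sum-cong-≗ (e-suc i)) (∑-e i))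

module _ {n : ℕ} where

  ∑-sift : (d : Fin n → ℚ) (i : Fin n) → ∑[ m < n ] (d m * e i m) ≡ d i
  ∑-sift d i = begin
    ∑[ m < n ] (d m * e i m)  ≡⟨ sum-cong-≗ (e-sift d i) ⟩
    ∑[ m < n ] (d i * e i m)  ≡⟨ *-distribˡ-sum (d i) (e i) ⟨
    d i * ∑[ m < n ] e i m    ≡⟨ cong (d i *_) (∑-e i) ⟩
    d i * 1ℚ                  ≡⟨ ℚ.*-identityʳ (d i) ⟩
    d i                       ∎

  ∑-*-root : (d : Fin n → ℚ) (i j : Fin n) → ∑[ m < n ] (d m * root (i , j) m) ≡ d i - d j
  ∑-*-root d i j = begin
    ∑[ m < n ] (d m * (e i m - e j m))
      ≡⟨ sum-cong-≗ (λ m → *-distribˡ-minus (d m) (e i m) (e j m)) ⟩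
    ∑[ m < n ] (d m * e i m - d m * e j m)
      ≡⟨ ∑-distrib-minus (λ m → d m * e i m) (λ m → d m * e j m) ⟩
    ∑[ m < n ] (d m * e i m) - ∑[ m < n ] (d m * e j m)
      ≡⟨ cong₂ _-_ (∑-sift d i) (∑-sift d j) ⟩
    d i - d j ∎

module _ {n : ℕ} {R : List (Fin n × Fin n)} where

  InSpan-resp-≗ : ∀ {x y} → x ≗ y → InSpan R x → InSpan R y
  InSpan-resp-≗ x≗y (cs , cs⊆R , x≗cs) = cs , cs⊆R , λ m → trans (sym (x≗y m)) (x≗cs m)

  InSpan-0 : InSpan R (λ _ → 0ℚ)
  InSpan-0 = [] , [] , λ _ → refl

  InSpan-∷ : ∀ {x} q {ij} → ij ∈ R → InSpan R x → InSpan R (λ m → q * root ij m + x m)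
  InSpan-∷ q {ij} ij∈R (cs , cs⊆R , x≗cs) =
    (q , ij) ∷ cs , ij∈R ∷ cs⊆R , λ m → cong (q * root ij m +_) (x≗cs m)

  InSpan-induction : (P : Vecℚ n → Set) → (∀ {x y} → x ≗ y → P x → P y) → P (λ _ → 0ℚ) →
    (∀ {x} q {ij} → ij ∈ R → P x → P (λ m → q * root ij m + x m)) →
    ∀ {x} → InSpan R x → P x
  InSpan-induction P P-resp P-0 P-∷ (cs , cs⊆R , x≗cs) = P-resp (sym ∘ x≗cs) (P-lincomb cs cs⊆R)
    where
    P-lincomb : ∀ cs → All (λ c → proj₂ c ∈ R) cs → P (lincomb cs)
    P-lincomb []             []             = P-0
    P-lincomb ((q , _) ∷ cs) (ij∈R ∷ cs⊆R) = P-∷ q ij∈R (P-lincomb cs cs⊆R)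

  InSpan-+ : ∀ {x y} → InSpan R x → InSpan R y → InSpan R (λ m → x m + y m)
  InSpan-+ {y = y} x∈ y∈ = InSpan-induction (λ x → InSpan R (λ m → x m + y m))
    (λ x≗x′ → InSpan-resp-≗ (λ m → cong (_+ y m) (x≗x′ m)))
    (InSpan-resp-≗ (λ m → sym (ℚ.+-identityˡ (y m))) y∈)
    (λ {x} q {ij} ij∈R x+y∈ →
      InSpan-resp-≗ (λ m → sym (ℚ.+-assoc (q * root ij m) (x m) (y m))) (InSpan-∷ q ij∈R x+y∈))
    x∈

  InSpan-*ᶠ : (d : Fin n → ℚ) → (∀ {i j} → (i , j) ∈ R → d i ≡ d j) →
              ∀ {x} → InSpan R x → InSpan R (λ m → d m * x m)
  InSpan-*ᶠ d d-const = InSpan-induction (λ x → InSpan R (λ m → d m * x m))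
    (λ x≗y → InSpan-resp-≗ (λ m → cong (d m *_) (x≗y m)))
    (InSpan-resp-≗ (λ m → sym (ℚ.*-zeroʳ (d m))) InSpan-0)
    step
    where
    step : ∀ {x} q {ij} → ij ∈ R → InSpan R (λ m → d m * x m) →
           InSpan R (λ m → d m * (q * root ij m + x m))
    step {x} q {i , j} ij∈R dx∈ =
      InSpan-resp-≗ (λ m → sym (*-distribˡ-+-sift d (d-const ij∈R) q x m)) (InSpan-∷ (q * d i) ij∈R dx∈)

  InSpan-* : ∀ q {x} → InSpan R x → InSpan R (λ m → q * x m)
  InSpan-* q = InSpan-*ᶠ (λ _ → q) (λ _ → refl)

  InSpan-∑ : ∀ {k} (v : Fin k → Vecℚ n) → (∀ t → InSpan R (v t)) → InSpan R (λ m → ∑[ t < k ] v t m)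
  InSpan-∑ {zero}  v v∈ = InSpan-0
  InSpan-∑ {suc k} v v∈ = InSpan-+ (v∈ zero) (InSpan-∑ (v ∘ suc) (v∈ ∘ suc))

  InSpan⇒∑≡0 : ∀ {x} → InSpan R x → ∑[ m < n ] x m ≡ 0ℚ
  InSpan⇒∑≡0 = InSpan-induction (λ x → ∑[ m < n ] x m ≡ 0ℚ)
    (λ x≗y ∑x≡0 → trans (sym (sum-cong-≗ x≗y)) ∑x≡0)
    (sum-replicate-zero n)
    step
    where
    step : ∀ {x} q {ij} → ij ∈ R → ∑[ m < n ] x m ≡ 0ℚ → ∑[ m < n ] (q * root ij m + x m) ≡ 0ℚ
    step {x} q {i , j} _ ∑x≡0 = begin
      ∑[ m < n ] (q * root (i , j) m + x m)              ≡⟨ ∑-distrib-+ (λ m → q * root (i , j) m) x ⟩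
      ∑[ m < n ] (q * root (i , j) m) + ∑[ m < n ] x m  ≡⟨ cong₂ _+_ (∑-*-root (λ _ → q) i j) ∑x≡0 ⟩
      (q - q) + 0ℚ                                       ≡⟨ cong (_+ 0ℚ) (ℚ.+-inverseʳ q) ⟩
      0ℚ                                                 ∎

module _ {n : ℕ} {R R′ : List (Fin n × Fin n)} where

  InSpan-mono : R ⊆ R′ → ∀ {x} → InSpan R x → InSpan R′ x
  InSpan-mono R⊆R′ (cs , cs⊆R , x≗cs) = cs , All.map R⊆R′ cs⊆R , x≗cs

  InSpan-trans : (∀ {ij} → ij ∈ R → InSpan R′ (root ij)) → ∀ {x} → InSpan R x → InSpan R′ x
  InSpan-trans roots∈ = InSpan-induction (InSpan R′) InSpan-resp-≗ InSpan-0
    (λ q ij∈R x∈ → InSpan-+ (InSpan-* q (roots∈ ij∈R)) x∈)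

record Linked {n} (R : List (Fin n × Fin n)) (i j : Fin n) : Set where
  constructor linked
  field inSpan : InSpan R (root (i , j))

open Linked public

module _ {n : ℕ} {R : List (Fin n × Fin n)} where

  Linked-refl : ∀ {i} → Linked R i i
  Linked-refl {i} = linked (InSpan-resp-≗ (λ m → sym (ℚ.+-inverseʳ (e i m))) InSpan-0)

  Linked-sym : ∀ {i j} → Linked R i j → Linked R j i
  Linked-sym {i} {j} (linked i~j) = linked (InSpan-resp-≗ flip (InSpan-* (- 1ℚ) i~j))
    where
    flip : ∀ m → - 1ℚ * root (i , j) m ≡ root (j , i) m
    flip m = solve 2 (λ x y → (:- con 1ℚ) :* (x :- y) := y :- x) refl (e i m) (e j m)

  Linked-trans : ∀ {i j l} → Linked R i j → Linked R j l → Linked R i l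
  Linked-trans {i} {j} {l} (linked i~j) (linked j~l) = linked (InSpan-resp-≗ telescope (InSpan-+ i~j j~l))
    where
    telescope : ∀ m → root (i , j) m + root (j , l) m ≡ root (i , l) m
    telescope m = solve 3 (λ x y z → (x :- y) :+ (y :- z) := x :- z) refl (e i m) (e j m) (e l m)

  edge⇒Linked : ∀ {i j} → (i , j) ∈ R → Linked R i j
  edge⇒Linked {i} {j} ij∈R = linked (InSpan-resp-≗ unit (InSpan-∷ 1ℚ ij∈R InSpan-0))
    where
    unit : ∀ m → 1ℚ * root (i , j) m + 0ℚ ≡ root (i , j) m
    unit m = trans (ℚ.+-identityʳ _) (ℚ.*-identityˡ _)

  Linked-mono : ∀ {R′} → R ⊆ R′ → ∀ {i j} → Linked R i j → Linked R′ i j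
  Linked-mono R⊆R′ (linked i~j) = linked (InSpan-mono R⊆R′ i~j)

module _ {n : ℕ} where

  merge : Fin n → Fin n → Fin n → Fin n
  merge x y v with v ≟ᶠ y
  ... | yes _ = x
  ... | no _  = v

  merge-hit : ∀ {x y v} → v ≡ y → merge x y v ≡ x
  merge-hit {x} {y} {v} v≡y with v ≟ᶠ y
  ... | yes _   = refl
  ... | no v≢y  = contradiction v≡y v≢y

  merge-miss : ∀ {x y v} → v ≢ y → merge x y v ≡ v
  merge-miss {x} {y} {v} v≢y with v ≟ᶠ y
  ... | yes v≡y = contradiction v≡y v≢y
  ... | no _    = refl

  merge-self : ∀ {x y} → merge x y x ≡ x
  merge-self {x} {y} with x ≟ᶠ y
  ... | yes _ = refl
  ... | no _  = refl

  componentLabel : List (Fin n × Fin n) → Fin n → Fin n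
  componentLabel []            m = m
  componentLabel ((a , b) ∷ R) m = merge (componentLabel R a) (componentLabel R b) (componentLabel R m)

  componentLabel-respects-edges : ∀ {R i j} → (i , j) ∈ R → componentLabel R i ≡ componentLabel R j
  componentLabel-respects-edges {(a , b) ∷ R} (here refl)  =
    trans merge-self (sym (merge-hit {x = componentLabel R a} {y = componentLabel R b} refl))
  componentLabel-respects-edges {(a , b) ∷ R} (there ij∈R) =
    cong (merge _ _) (componentLabel-respects-edges ij∈R)

  sameComponentLabel⇒Linked : ∀ R {i j} → componentLabel R i ≡ componentLabel R j → Linked R i j
  sameComponentLabel⇒Linked []            refl = Linked-refl
  sameComponentLabel⇒Linked ((a , b) ∷ R) {i} {j} cᵢ≡cⱼ = by-cases (c i ≟ᶠ c b) (c j ≟ᶠ c b)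
    where
    c : Fin n → Fin n
    c = componentLabel R

    R′ : List (Fin n × Fin n)
    R′ = (a , b) ∷ R

    viaR : ∀ {i j} → c i ≡ c j → Linked R′ i j
    viaR = Linked-mono there ∘ sameComponentLabel⇒Linked R

    across : ∀ {i j} → c i ≡ c b → c a ≡ c j → Linked R′ i j
    across ib aj = Linked-trans (viaR ib) (Linked-trans (Linked-sym (edge⇒Linked (here refl))) (viaR aj))

    by-cases : Dec (c i ≡ c b) → Dec (c j ≡ c b) → Linked R′ i j
    by-cases (yes ib) (yes jb) = viaR (trans ib (sym jb))
    by-cases (yes ib) (no jb)  = across ib (trans (sym (merge-hit ib)) (trans cᵢ≡cⱼ (merge-miss jb)))
    by-cases (no ib)  (yes jb) =
      Linked-sym (across jb (trans (sym (merge-hit jb)) (trans (sym cᵢ≡cⱼ) (merge-miss ib))))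
    by-cases (no ib)  (no jb)  = viaR (trans (sym (merge-miss ib)) (trans cᵢ≡cⱼ (merge-miss jb)))

  Linked⇒sameComponentLabel : ∀ {R i j} → Linked R i j → componentLabel R i ≡ componentLabel R j
  Linked⇒sameComponentLabel {R} {i} {j} i~j = by-cases (c j ≟ᶠ c i)
    where
    c : Fin n → Fin n
    c = componentLabel R

    d : Fin n → ℚ
    d m = 𝟙 (c m ≟ᶠ c i)

    dᵢ-dⱼ≡0 : d i - d j ≡ 0ℚ
    dᵢ-dⱼ≡0 = trans (sym (∑-*-root d i j))
      (InSpan⇒∑≡0 (InSpan-*ᶠ d (cong (λ v → 𝟙 (v ≟ᶠ c i)) ∘ componentLabel-respects-edges)
                                (inSpan i~j)))

    by-cases : Dec (c j ≡ c i) → c i ≡ c j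
    by-cases (yes cⱼ≡cᵢ) = sym cⱼ≡cᵢ
    by-cases (no cⱼ≢cᵢ)  = contradiction (trans (sym dᵢ-dⱼ≡1-0) dᵢ-dⱼ≡0) ℚ.1≢0
      where
      dᵢ-dⱼ≡1-0 : d i - d j ≡ 1ℚ - 0ℚ
      dᵢ-dⱼ≡1-0 = cong₂ _-_ (𝟙-yes (c i ≟ᶠ c i) refl) (𝟙-no (c j ≟ᶠ c i) cⱼ≢cᵢ)

module Classes {n : ℕ} {A : Set} (_≟_ : DecidableEquality A) (κ : Fin n → A) where

  restrict : Fin n → Vecℚ n → Vecℚ n
  restrict m₀ y m = 𝟙 (κ m ≟ κ m₀) * y m

  classSum : Fin n → Vecℚ n → ℚ
  classSum m₀ y = ∑[ m < n ] restrict m₀ y m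

  SameClassRoot : Fin n × Fin n → Set
  SameClassRoot ij = proj₁ ij ≢ proj₂ ij × κ (proj₁ ij) ≡ κ (proj₂ ij)

  sameClassRoot? : Decidable SameClassRoot
  sameClassRoot? (i , j) = ¬? (i ≟ᶠ j) ×-dec (κ i ≟ κ j)

  sameClassRoots : List (Fin n × Fin n)
  sameClassRoots = filter sameClassRoot? (cartesianProduct (allFin n) (allFin n))

  sameClassRoots-sound : All SameClassRoot sameClassRoots
  sameClassRoots-sound =
    All.tabulate (proj₂ ∘ ∈-filter⁻ sameClassRoot? {xs = cartesianProduct (allFin n) (allFin n)})

  sameClass⇒Linked : ∀ {i j} → κ i ≡ κ j → Linked sameClassRoots i j
  sameClass⇒Linked {i} {j} κᵢ≡κⱼ with i ≟ᶠ j
  ... | yes refl = Linked-refl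
  ... | no i≢j   = edge⇒Linked
    (∈-filter⁺ sameClassRoot? (∈-cartesianProduct⁺ (∈-allFin i) (∈-allFin j)) (i≢j , κᵢ≡κⱼ))

  private
    -- The witness is irrelevant, so the point picked depends on the label v alone.
    pick : (v : A) → .(∃ λ p → κ p ≡ v) → ∃ λ p → κ p ≡ v
    pick v w with any? (λ p → κ p ≟ v)
    ... | yes w′ = w′
    ... | no ∄w  = ⊥-elim-irr (∄w w)

    pick-cong : ∀ {v v′} .{w w′} → v ≡ v′ → proj₁ (pick v w) ≡ proj₁ (pick v′ w′)
    pick-cong refl = refl

  representative : Fin n → Fin n
  representative m = proj₁ (pick (κ m) (m , refl))

  κ-representative : ∀ m → κ (representative m) ≡ κ m
  κ-representative m = proj₂ (pick (κ m) (m , refl))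

  representative-cong : ∀ {m m′} → κ m ≡ κ m′ → representative m ≡ representative m′
  representative-cong = pick-cong

  classSums≡0⇒InSpan : ∀ {R} → (∀ {i j} → κ i ≡ κ j → Linked R i j) →
                          ∀ {z} → (∀ m₀ → classSum m₀ z ≡ 0ℚ) → InSpan R z
  classSums≡0⇒InSpan {R} sameκ⇒Linked {z} classSums≡0 = InSpan-resp-≗ decompose
    (InSpan-∑ (λ m p → z m * root (m , r m) p)
              (λ m → InSpan-* (z m) (inSpan (sameκ⇒Linked (sym (κ-representative m))))))
    where
    r : Fin n → Fin n
    r = representative

    atRepresentatives≡0 : ∀ p → ∑[ m < n ] (z m * e (r m) p) ≡ 0ℚ
    atRepresentatives≡0 p = by-cases (r p ≟ᶠ p)
      where
      by-cases : Dec (r p ≡ p) → ∑[ m < n ] (z m * e (r m) p) ≡ 0ℚ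
      by-cases (yes rₚ≡p) = trans (sum-cong-≗ toRestrict) (classSums≡0 p)
        where
        rₘ≡p⇔κₘ≡κₚ : ∀ m → r m ≡ p ⇔ κ m ≡ κ p
        rₘ≡p⇔κₘ≡κₚ m = mk⇔ (λ rₘ≡p → trans (sym (κ-representative m)) (cong κ rₘ≡p))
                             (λ κₘ≡κₚ → trans (representative-cong κₘ≡κₚ) rₚ≡p)
        toRestrict : ∀ m → z m * e (r m) p ≡ restrict p z m
        toRestrict m = trans (ℚ.*-comm (z m) _)
          (cong (_* z m) (trans (e≡𝟙 (r m) p) (𝟙-cong (rₘ≡p⇔κₘ≡κₚ m) (r m ≟ᶠ p) (κ m ≟ κ p))))
      by-cases (no rₚ≢p) = trans (sum-cong-≗ vanish) (sum-replicate-zero n)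
        where
        vanish : ∀ m → z m * e (r m) p ≡ 0ℚ
        vanish m =
          trans (cong (z m *_) (trans (e≡𝟙 (r m) p) (𝟙-no (r m ≟ᶠ p) rₘ≢p))) (ℚ.*-zeroʳ (z m))
          where
          rₘ≢p : r m ≢ p
          rₘ≢p rₘ≡p =
            rₚ≢p (trans (cong r (sym rₘ≡p)) (trans (representative-cong (κ-representative m)) rₘ≡p))

    decompose : ∀ p → ∑[ m < n ] (z m * root (m , r m) p) ≡ z p
    decompose p = begin
      ∑[ m < n ] (z m * root (m , r m) p)
        ≡⟨ ℚ.+-identityʳ _ ⟨
      ∑[ m < n ] (z m * root (m , r m) p) + 0ℚ
        ≡⟨ cong (∑[ m < n ] (z m * root (m , r m) p) +_) (atRepresentatives≡0 p) ⟨
      ∑[ m < n ] (z m * root (m , r m) p) + ∑[ m < n ] (z m * e (r m) p)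
        ≡⟨ ∑-distrib-+ (λ m → z m * root (m , r m) p) (λ m → z m * e (r m) p) ⟨
      ∑[ m < n ] (z m * root (m , r m) p + z m * e (r m) p)
        ≡⟨ sum-cong-≗ (λ m → solve 3 (λ a x y → a :* (x :- y) :+ a :* y := a :* x) refl
                                      (z m) (e m p) (e (r m) p)) ⟩
      ∑[ m < n ] (z m * e m p)
        ≡⟨ sum-cong-≗ (λ m → cong (z m *_) (e-comm m p)) ⟩
      ∑[ m < n ] (z m * e p m)
        ≡⟨ ∑-sift z p ⟩
      z p ∎

module _ {n : ℕ} {A : Set} (_≟_ : DecidableEquality A) where

  jointLabel : ∀ {k} → (Fin k → Fin n → A) → Fin n → Vec A k
  jointLabel κ m = tabulate (λ t → κ t m)

  jointLabel-≡ : ∀ {k} (κ : Fin k → Fin n → A) {i j} →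
                 jointLabel κ i ≡ jointLabel κ j → ∀ t → κ t i ≡ κ t j
  jointLabel-≡ κ {i} {j} eq t = begin
    κ t i                           ≡⟨ lookup∘tabulate (λ t → κ t i) t ⟨
    lookup (jointLabel κ i) t       ≡⟨ cong (λ v → lookup v t) eq ⟩
    lookup (jointLabel κ j) t       ≡⟨ lookup∘tabulate (λ t → κ t j) t ⟩
    κ t j                           ∎

  𝟙-∷ : ∀ {k} {x y : A} {xs ys : Vec A k} →
        𝟙 (≡-dec _≟_ (x ∷ xs) (y ∷ ys)) ≡ 𝟙 (x ≟ y) * 𝟙 (≡-dec _≟_ xs ys)
  𝟙-∷ {x = x} {y} {xs} {ys} = trans
    (𝟙-cong (mk⇔ ∷-injective (uncurry (cong₂ _∷_)))
            (≡-dec _≟_ (x ∷ xs) (y ∷ ys)) (x ≟ y ×-dec ≡-dec _≟_ xs ys))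
    (𝟙-× (x ≟ y) (≡-dec _≟_ xs ys))

  restrict-jointLabel-closed : (P : Vecℚ n → Set) → (∀ {x y} → x ≗ y → P x → P y) →
    ∀ {k} (κ : Fin k → Fin n → A) →
    (∀ t m₀ {y} → P y → P (Classes.restrict _≟_ (κ t) m₀ y)) →
    ∀ m₀ {y} → P y → P (Classes.restrict (≡-dec _≟_) (jointLabel κ) m₀ y)
  restrict-jointLabel-closed P P-resp {zero}  κ P-restrict m₀ {y} Py =
    P-resp (λ m → sym (ℚ.*-identityˡ (y m))) Py
  restrict-jointLabel-closed P P-resp {suc k} κ P-restrict m₀ {y} Py =
    P-resp factor
      (restrict-jointLabel-closed P P-resp (κ ∘ suc) (P-restrict ∘ suc) m₀ (P-restrict zero m₀ Py))
    where
    factor : Classes.restrict (≡-dec _≟_) (jointLabel (κ ∘ suc)) m₀ (Classes.restrict _≟_ (κ zero) m₀ y)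
           ≗ Classes.restrict (≡-dec _≟_) (jointLabel κ) m₀ y
    factor m = begin
      b * (a * y m)   ≡⟨ solve 3 (λ a b y → b :* (a :* y) := a :* b :* y) refl a b (y m) ⟩
      a * b * y m     ≡⟨ cong (_* y m) 𝟙-∷ ⟨
      Classes.restrict (≡-dec _≟_) (jointLabel κ) m₀ y m ∎
      where
      a b : ℚ
      a = 𝟙 (κ zero m ≟ κ zero m₀)
      b = 𝟙 (≡-dec _≟_ (jointLabel (κ ∘ suc) m) (jointLabel (κ ∘ suc) m₀))

module Intersection {n k : ℕ} (L : Fin k → Vecℚ n → Set)
  (L-root : ∀ s → IsRootSubspace (L s))
  (L∩L-root : ∀ s t → IsRootSubspace (λ x → L s x × L t x)) where

  R : Fin k → List (Fin n × Fin n)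
  R s = proj₁ (L-root s)

  L⇔InSpan : ∀ s {x} → L s x ⇔ InSpan (R s) x
  L⇔InSpan s = proj₂ (proj₂ (L-root s)) _

  ⋂L : Vecℚ n → Set
  ⋂L y = ∀ s → L s y

  ⋂L-resp-≗ : ∀ {x y} → x ≗ y → ⋂L x → ⋂L y
  ⋂L-resp-≗ x≗y x∈ s = from (L⇔InSpan s) (InSpan-resp-≗ x≗y (to (L⇔InSpan s) (x∈ s)))

  label : Fin k → Fin n → Fin n
  label t = componentLabel (R t)

  key : Fin n → Vec (Fin n) k
  key = jointLabel _≟ᶠ_ label

  open Classes (≡-dec _≟ᶠ_) key public

  ⋂L-restrict-label : ∀ t m₀ {y} → ⋂L y → ⋂L (Classes.restrict _≟ᶠ_ (label t) m₀ y)
  ⋂L-restrict-label t m₀ {y} y∈⋂ s =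
    proj₁ (from (L∩L⇔InSpan _) (InSpan-*ᶠ d d-const (to (L∩L⇔InSpan y) (y∈⋂ s , y∈⋂ t))))
    where
    Rₛₜ : List (Fin n × Fin n)
    Rₛₜ = proj₁ (L∩L-root s t)

    L∩L⇔InSpan : ∀ x → (L s x × L t x) ⇔ InSpan Rₛₜ x
    L∩L⇔InSpan = proj₂ (proj₂ (L∩L-root s t))

    d : Fin n → ℚ
    d m = 𝟙 (label t m ≟ᶠ label t m₀)

    edge∈Lₜ : ∀ {i j} → (i , j) ∈ Rₛₜ → L t (root (i , j))
    edge∈Lₜ ij∈Rₛₜ = proj₂ (from (L∩L⇔InSpan _) (inSpan (edge⇒Linked ij∈Rₛₜ)))

    d-const : ∀ {i j} → (i , j) ∈ Rₛₜ → d i ≡ d j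
    d-const ij∈Rₛₜ = cong (λ v → 𝟙 (v ≟ᶠ label t m₀))
      (Linked⇒sameComponentLabel (linked (to (L⇔InSpan t) (edge∈Lₜ ij∈Rₛₜ))))

  ⋂L⇒InSpan : Fin k → ∀ {y} → ⋂L y → InSpan sameClassRoots y
  ⋂L⇒InSpan s₀ {y} y∈⋂ = classSums≡0⇒InSpan sameClass⇒Linked classSum≡0
    where
    classSum≡0 : ∀ m₀ → classSum m₀ y ≡ 0ℚ
    classSum≡0 m₀ = InSpan⇒∑≡0 (to (L⇔InSpan s₀)
      (restrict-jointLabel-closed _≟ᶠ_ ⋂L ⋂L-resp-≗ label ⋂L-restrict-label m₀ y∈⋂ s₀))

  InSpan⇒⋂L : ∀ {y} → InSpan sameClassRoots y → ⋂L y
  InSpan⇒⋂L y∈ s = from (L⇔InSpan s) (InSpan-trans root∈ y∈)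
    where
    root∈ : ∀ {ij} → ij ∈ sameClassRoots → InSpan (R s) (root ij)
    root∈ ij∈ = inSpan (sameComponentLabel⇒Linked (R s)
      (jointLabel-≡ _≟ᶠ_ label (proj₂ (All.lookup sameClassRoots-sound ij∈)) s))

proposition2p2 : (n k : ℕ) → 1 ≤ k → (L : Fin k → Vecℚ n → Set) →
    (∀ s → IsRootSubspace (L s)) →
    (∀ s t → IsRootSubspace (λ x → L s x × L t x)) →
    IsRootSubspace (λ x → ∀ s → L s x)
proposition2p2 n k k≥1 L L-root L∩L-root =
  sameClassRoots , All.map proj₁ sameClassRoots-sound , λ _ → mk⇔ (⋂L⇒InSpan (fromℕ< k≥1)) InSpan⇒⋂L
  where open Intersection L L-root L∩L-root
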